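{- Let $G$ be a quasi-tree such that at least one of the following holds: (i) $G$ contains no pendent vertices (vertices of degree $1$); (ii) $G$ contains a quasi-vertex $x$ none of whose neighbors has degree $2$ in $G$. Then ${\rm gp}(G)\geq {\rm Z}(G)$.
   Context: All graphs are finite and simple. A graph $G$ is a quasi-tree if it contains a vertex $v$ such that $G-v$ is a tree; such a $v$ is called a quasi-vertex of $G$. Zero forcing: given a set $S\subseteq V(G)$ of initially black vertices (all others white), the color-change rule turns a white vertex $y$ black if $y$ is the only white neighbor of some black vertex $x$. ${\rm Z}(G)$ is the minimum size of a set $S$ such that repeated application of the rule eventually turns all vertices black. A set $R\subseteq V(G)$ is a general position set if no three vertices of $R$ lie on a common shortest path of $G$; ${\rm gp}(G)$ is the maximum size of a general position set of $G$. -}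

module Defs where

open import Data.Nat using (ℕ; zero; suc; _≤_; _≥_)
open import Data.Bool using (Bool; true; false)
open import Data.Fin using (Fin; punchIn)
open import Data.Fin.Subset using (Subset; _∈_; ∣_∣)
open import Data.Vec using (tabulate)
open import Data.List using (List; []; _∷_; length; head; last)
open import Data.List.Relation.Unary.Unique.Propositional using (Unique)
open import Data.Maybe using (just)
open import Data.Product using (Σ; ∃; _×_; _,_)
open import Data.Sum using (_⊎_)
open import Data.Unit using (⊤)
open import Relation.Nullary using (¬_)
open import Relation.Binary.PropositionalEquality using (_≡_; _≢_)
open import Data.Fin.Properties using (punchIn-injective)

record Graph (n : ℕ) : Set where
  field
    adj    : Fin n → Fin n → Bool
    sym    : ∀ i j → adj i j ≡ adj j i
    irrefl : ∀ i → adj i i ≡ false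
open Graph public

module _ {n : ℕ} (G : Graph n) where

  Adj : Fin n → Fin n → Set
  Adj i j = adj G i j ≡ true

  nbhd : Fin n → Subset n
  nbhd v = tabulate (adj G v)

  deg : Fin n → ℕ
  deg v = ∣ nbhd v ∣

  data Walk : Fin n → Fin n → ℕ → Set where
    here : ∀ u → Walk u u 0
    step : ∀ {u w v k} → Adj u w → Walk w v k → Walk u v (suc k)

  data OnWalk (x : Fin n) : ∀ {u v k} → Walk u v k → Set where
    at-here  : OnWalk x (here x)
    at-start : ∀ {w v k} (a : Adj x w) (p : Walk w v k) → OnWalk x (step a p)
    later    : ∀ {u w v k} (a : Adj u w) {p : Walk w v k} → OnWalk x p → OnWalk x (step a p)

  -- a shortest u,v-path: a u,v-walk of minimum length (necessarily a path)
  Shortest : ∀ {u v k} → Walk u v k → Set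
  Shortest {u} {v} {k} _ = ∀ k' → Walk u v k' → k ≤ k'

  Connected : Set
  Connected = ∀ u v → ∃ λ k → Walk u v k

  data Chain : List (Fin n) → Set where
    c-nil  : Chain []
    c-one  : ∀ x → Chain (x ∷ [])
    c-cons : ∀ x y zs → Adj x y → Chain (y ∷ zs) → Chain (x ∷ y ∷ zs)

  IsCycle : List (Fin n) → Set
  IsCycle cs = (3 ≤ length cs) × Unique cs × Chain cs
             × Σ (Fin n) λ a → Σ (Fin n) λ b →
                 (head cs ≡ just a) × (last cs ≡ just b) × Adj b a

  Acyclic : Set
  Acyclic = ∀ cs → ¬ IsCycle cs

  -- a tree: nonempty, connected, acyclic
  IsTree : Set
  IsTree = Fin n × Connected × Acyclic

  data Black (S : Subset n) : Fin n → Set where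
    initial : ∀ {y} → y ∈ S → Black S y
    force   : ∀ {x y} → Black S x → Adj x y
            → (∀ z → Adj x z → z ≢ y → Black S z) → Black S y

  ZeroForcing : Subset n → Set
  ZeroForcing S = ∀ v → Black S v

  IsZ : ℕ → Set
  IsZ k = (Σ (Subset n) λ S → ZeroForcing S × ∣ S ∣ ≡ k)
        × (∀ S → ZeroForcing S → k ≤ ∣ S ∣)

  OnCommonGeodesic : Fin n → Fin n → Fin n → Set
  OnCommonGeodesic x y z =
    Σ (Fin n) λ u → Σ (Fin n) λ v → Σ ℕ λ k → Σ (Walk u v k) λ p →
      Shortest p × OnWalk x p × OnWalk y p × OnWalk z p

  GeneralPosition : Subset n → Set
  GeneralPosition R = ∀ x y z → x ∈ R → y ∈ R → z ∈ R →
    x ≢ y → y ≢ z → x ≢ z → ¬ OnCommonGeodesic x y z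

  IsGP : ℕ → Set
  IsGP k = (Σ (Subset n) λ R → GeneralPosition R × ∣ R ∣ ≡ k)
         × (∀ R → GeneralPosition R → ∣ R ∣ ≤ k)

deleteVertex : {m : ℕ} → Graph (suc m) → Fin (suc m) → Graph m
deleteVertex G v = record
  { adj    = λ i j → adj G (punchIn v i) (punchIn v j)
  ; sym    = λ i j → sym G (punchIn v i) (punchIn v j)
  ; irrefl = λ i → irrefl G (punchIn v i)
  }

IsQuasiVertex : {m : ℕ} → Graph (suc m) → Fin (suc m) → Set
IsQuasiVertex G v = IsTree (deleteVertex G v)

-- quasi-tree (a graph with no vertices has no quasi-vertex)
IsQuasiTree : {m : ℕ} → Graph (suc m) → Set
IsQuasiTree G = ∃ λ v → IsQuasiVertex G v

-- Let q be a quasi-vertex, T = G − q, and L the set of pendant vertices of T (T has at least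
-- two vertices; the two-vertex graph is checked directly). Fix u ∈ L. Then (L − u) ∪ {q} is
-- zero forcing: shrink T leaf by leaf, keeping u until it is isolated; every removed leaf is
-- black and forces its only remaining neighbour, since its other neighbours are removed
-- vertices or q, all black. Hence Z(G) ≤ |L|. Under (ii), taking q to be the quasi-vertex
-- given there, every vertex of L has degree 1 in G, and such a vertex is never strictly
-- inside a shortest path. Under (i) every vertex of L is adjacent to q (its degree in G is
-- not 1), so a vertex of L between two others on a shortest path is adjacent to one of
-- them, which forces T = K₂. Either way L is in general position, so |L| ≤ gp(G).
module Submission where

open import Defs hiding (sym)
open import Data.Nat using (ℕ; zero; suc; _+_; _≤_; _<_; z≤n; s≤s)
open import Data.Nat.Properties
  renaming (_≟_ to _≟ℕ_)
  using (≤-refl; ≤-reflexive; ≤-trans; ≤-antisym; ≤-pred; n≤0⇒n≡0; +-suc; +-comm; +-assoc;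
         +-monoʳ-≤; +-cancelˡ-≤; +-cancelʳ-≤; module ≤-Reasoning; m+n≤o⇒n≤o; 1+n≰n; <⇒≤)
open import Data.Bool using (Bool; true; false)
open import Data.Fin using (Fin; zero; suc; punchIn; punchOut)
open import Data.Fin.Properties using (any?; punchIn-injective; punchIn-punchOut)
  renaming (_≟_ to _≟ᶠ_)
open import Data.Fin.Subset
  using (Subset; inside; outside; _∈_; _∉_; ∣_∣; ⊤; ⁅_⁆; _∩_; _∪_; _-_; _⊆_; Nonempty; Empty)
open import Data.Fin.Subset.Properties
  using (_∈?_; nonempty?; Empty-unique; ∣⊥∣≡0; ∣⁅x⁆∣≡1; x∈⁅x⁆; ∈⊤; ∣p∣≤∣x∷p∣;
         p⊆q⇒∣p∣≤∣q∣; x∈p⇒∣p-x∣<∣p∣; x∈p∧x≢y⇒x∈p-y; p─q⊆p; x∈p∩q⁺; x∈p∩q⁻; x∈p∪q⁺; ∩-identityˡ)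
open import Data.Vec using ([]; _∷_; tabulate)
open import Data.Vec.Properties using (lookup⇒[]=; []=⇒lookup; lookup∘tabulate)
open import Data.List using (List; []; _∷_; length; last)
open import Data.List.Membership.Propositional using () renaming (_∈_ to _∈ₗ_; _∉_ to _∉ₗ_)
open import Data.List.Relation.Unary.Any using (here; there)
open import Data.List.Relation.Unary.All as All using (All; []; _∷_)
open import Data.List.Relation.Unary.All.Properties.Core using (¬Any⇒All¬)
open import Data.List.Relation.Unary.AllPairs using ([]; _∷_)
open import Data.List.Relation.Unary.Unique.Propositional using (Unique)
open import Data.Maybe using (just)
open import Data.Product using (Σ; ∃; _×_; _,_; proj₁; proj₂; uncurry)
open import Data.Sum using (_⊎_; inj₁; inj₂; map₁)
open import Data.Empty using (⊥-elim)
open import Relation.Nullary using (¬_; Dec; yes; no; ¬?; _×-dec_; does)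
open import Relation.Nullary.Decidable using (dec-true)
open import Relation.Binary.PropositionalEquality
open import Function using (_∘_)

∣p∪q∣≤∣p∣+∣q∣ : ∀ {n} (p q : Subset n) → ∣ p ∪ q ∣ ≤ ∣ p ∣ + ∣ q ∣
∣p∪q∣≤∣p∣+∣q∣ []            []            = z≤n
∣p∪q∣≤∣p∣+∣q∣ (outside ∷ p) (outside ∷ q) = ∣p∪q∣≤∣p∣+∣q∣ p q
∣p∪q∣≤∣p∣+∣q∣ (outside ∷ p) (inside ∷ q)  =
  ≤-trans (s≤s (∣p∪q∣≤∣p∣+∣q∣ p q)) (≤-reflexive (sym (+-suc ∣ p ∣ ∣ q ∣)))
∣p∪q∣≤∣p∣+∣q∣ (inside ∷ p)  (b ∷ q)       =
  s≤s (≤-trans (∣p∪q∣≤∣p∣+∣q∣ p q) (+-monoʳ-≤ ∣ p ∣ (∣p∣≤∣x∷p∣ b q)))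

module _ {n : ℕ} where

  x∈p⇒0<∣p∣ : ∀ {p : Subset n} {x} → x ∈ p → 0 < ∣ p ∣
  x∈p⇒0<∣p∣ x∈p = ≤-trans (s≤s z≤n) (x∈p⇒∣p-x∣<∣p∣ x∈p)

  x∈p∧y∈p∧x≢y⇒1<∣p∣ : ∀ {p : Subset n} {x y} → x ∈ p → y ∈ p → x ≢ y → 1 < ∣ p ∣
  x∈p∧y∈p∧x≢y⇒1<∣p∣ x∈p y∈p x≢y =
    ≤-trans (s≤s (x∈p⇒0<∣p∣ (x∈p∧x≢y⇒x∈p-y y∈p (x≢y ∘ sym)))) (x∈p⇒∣p-x∣<∣p∣ x∈p)

  ∣p∣≤1⇒x∈p∧y∈p⇒x≡y : ∀ {p : Subset n} → ∣ p ∣ ≤ 1 → ∀ {x y} → x ∈ p → y ∈ p → x ≡ y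
  ∣p∣≤1⇒x∈p∧y∈p⇒x≡y ∣p∣≤1 {x} {y} x∈p y∈p with x ≟ᶠ y
  ... | yes x≡y = x≡y
  ... | no  x≢y with ≤-trans (x∈p∧y∈p∧x≢y⇒1<∣p∣ x∈p y∈p x≢y) ∣p∣≤1
  ...   | s≤s ()

  p⊆⁅x⁆⇒∣p∣≤1 : ∀ {p : Subset n} {x} → p ⊆ ⁅ x ⁆ → ∣ p ∣ ≤ 1
  p⊆⁅x⁆⇒∣p∣≤1 {x = x} p⊆⁅x⁆ = ≤-trans (p⊆q⇒∣p∣≤∣q∣ p⊆⁅x⁆) (≤-reflexive (∣⁅x⁆∣≡1 x))

  Empty⇒∣p∣≡0 : ∀ {p : Subset n} → Empty p → ∣ p ∣ ≡ 0
  Empty⇒∣p∣≡0 empty = trans (cong ∣_∣ (Empty-unique empty)) (∣⊥∣≡0 n)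

∈tabulate⁺ : ∀ {n} {f : Fin n → Bool} {v} → f v ≡ true → v ∈ tabulate f
∈tabulate⁺ {f = f} {v} fv = lookup⇒[]= v (tabulate f) (trans (lookup∘tabulate f v) fv)

∈tabulate⁻ : ∀ {n} {f : Fin n → Bool} {v} → v ∈ tabulate f → f v ≡ true
∈tabulate⁻ {f = f} {v} v∈ = trans (sym (lookup∘tabulate f v)) ([]=⇒lookup v∈)

∣x∷p∣≡∣x∷q∣ : ∀ {n} x (p q : Subset n) → ∣ p ∣ ≡ ∣ q ∣ → ∣ x ∷ p ∣ ≡ ∣ x ∷ q ∣
∣x∷p∣≡∣x∷q∣ outside _ _ eq = eq
∣x∷p∣≡∣x∷q∣ inside  _ _ eq = cong suc eq

∣x∷y∷p∣≡∣y∷x∷p∣ : ∀ {n} x y (p : Subset n) → ∣ x ∷ y ∷ p ∣ ≡ ∣ y ∷ x ∷ p ∣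
∣x∷y∷p∣≡∣y∷x∷p∣ outside outside p = refl
∣x∷y∷p∣≡∣y∷x∷p∣ outside inside  p = refl
∣x∷y∷p∣≡∣y∷x∷p∣ inside  outside p = refl
∣x∷y∷p∣≡∣y∷x∷p∣ inside  inside  p = refl

∣tabulate∣-punchIn : ∀ {m} (h : Fin (suc m) → Bool) (q : Fin (suc m)) →
                     ∣ tabulate h ∣ ≡ ∣ h q ∷ tabulate (h ∘ punchIn q) ∣
∣tabulate∣-punchIn h zero = refl
∣tabulate∣-punchIn {suc m} h (suc q) =
  trans (∣x∷p∣≡∣x∷q∣ (h zero) (tabulate (h ∘ suc)) (h (suc q) ∷ rest) (∣tabulate∣-punchIn (h ∘ suc) q))
        (∣x∷y∷p∣≡∣y∷x∷p∣ (h zero) (h (suc q)) rest)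
  where rest = tabulate (h ∘ suc ∘ punchIn q)

module _ {n : ℕ} (G : Graph n) where

  Adj⇒∈nbhd : ∀ {v w} → Adj G v w → w ∈ nbhd G v
  Adj⇒∈nbhd = ∈tabulate⁺

  ∈nbhd⇒Adj : ∀ {v w} → w ∈ nbhd G v → Adj G v w
  ∈nbhd⇒Adj = ∈tabulate⁻

  Adj-sym : ∀ {v w} → Adj G v w → Adj G w v
  Adj-sym {v} {w} e = trans (Graph.sym G w v) e

  Adj⇒≢ : ∀ {v w} → Adj G v w → v ≢ w
  Adj⇒≢ {v} e refl with trans (sym e) (irrefl G v)
  ... | ()

  deg≡1⇒neighbour-unique : ∀ {v x y} → deg G v ≡ 1 → Adj G v x → Adj G v y → x ≡ y
  deg≡1⇒neighbour-unique d≡1 e e′ =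
    ∣p∣≤1⇒x∈p∧y∈p⇒x≡y (≤-reflexive d≡1) (Adj⇒∈nbhd e) (Adj⇒∈nbhd e′)

  connected⇒0<deg : Connected G → ∀ {v w} → v ≢ w → 0 < deg G v
  connected⇒0<deg conn {v} {w} v≢w with conn v w
  ... | zero  , here _ = ⊥-elim (v≢w refl)
  ... | suc _ , step e _ = x∈p⇒0<∣p∣ (Adj⇒∈nbhd e)

  adjacentPendants-closed : ∀ {a b} → deg G a ≡ 1 → deg G b ≡ 1 → Adj G a b →
                            ∀ {x v k} → x ≡ a ⊎ x ≡ b → Walk G x v k → v ≡ a ⊎ v ≡ b
  adjacentPendants-closed da db ab x∈ab (here _) = x∈ab
  adjacentPendants-closed da db ab (inj₁ refl) (step e p) =
    adjacentPendants-closed da db ab (inj₂ (deg≡1⇒neighbour-unique da e ab)) p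
  adjacentPendants-closed da db ab (inj₂ refl) (step e p) =
    adjacentPendants-closed da db ab (inj₁ (deg≡1⇒neighbour-unique db e (Adj-sym ab))) p

  _++ʷ_ : ∀ {u v w k l} → Walk G u v k → Walk G v w l → Walk G u w (k + l)
  here _   ++ʷ q = q
  step e p ++ʷ q = step e (p ++ʷ q)

  unsnoc : ∀ {u v k} → Walk G u v (suc k) → ∃ λ w → Walk G u w k × Adj G w v
  unsnoc (step e (here _))   = _ , here _ , e
  unsnoc (step e (step f p)) with unsnoc (step f p)
  ... | w , p′ , e′ = w , step e p′ , e′

  record Split {u v k} (x : Fin n) (p : Walk G u v k) : Set where
    constructor split-at
    field
      {i j}   : ℕ
      prefix  : Walk G u x i
      suffix  : Walk G x v j
      lengths : i + j ≡ k
      cover   : ∀ {y} → OnWalk G y p → OnWalk G y prefix ⊎ OnWalk G y suffix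

  split : ∀ {x u v k} {p : Walk G u v k} → OnWalk G x p → Split x p
  split {x} at-here        = split-at (here x) (here x) refl inj₁
  split {x} (at-start e p) = split-at (here x) (step e p) refl inj₂
  split (later e {p} x∈p) with split x∈p
  ... | split-at p₁ p₂ eq cover = split-at (step e p₁) p₂ (cong suc eq) cover′
    where
    cover′ : ∀ {y} → OnWalk G y (step e p) → OnWalk G y (step e p₁) ⊎ OnWalk G y p₂
    cover′ (at-start _ _) = inj₁ (at-start e p₁)
    cover′ (later _ y∈p) with cover y∈p
    ... | inj₁ y∈p₁ = inj₁ (later e y∈p₁)
    ... | inj₂ y∈p₂ = inj₂ y∈p₂

  Between : Fin n → Fin n → Fin n → Set
  Between a b c = Σ ℕ λ i → Σ ℕ λ j → Walk G a b i × Walk G b c j × (∀ k → Walk G a c k → i + j ≤ k)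

  shortest⇒between : ∀ {s t k a b c l₁ i j l₄} (p : Walk G s t k) → Shortest G p →
                     Walk G s a l₁ → Walk G a b i → Walk G b c j → Walk G c t l₄ →
                     l₁ + (i + (j + l₄)) ≡ k → Between a b c
  shortest⇒between {l₁ = l₁} {i} {j} {l₄} p shortest w₁ w₂ w₃ w₄ refl = i , j , w₂ , w₃ , λ k w →
    +-cancelʳ-≤ l₄ (i + j) k (subst (_≤ k + l₄) (sym (+-assoc i j l₄))
      (+-cancelˡ-≤ l₁ _ _ (shortest _ (w₁ ++ʷ (w ++ʷ w₄)))))

  NoneBetween : Subset n → Set
  NoneBetween R = ∀ {a b c} → a ∈ R → b ∈ R → c ∈ R → a ≢ b → b ≢ c → a ≢ c → ¬ Between a b c

  noneBetween⇒generalPosition : ∀ {R} → NoneBetween R → GeneralPosition G R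
  -- Split the geodesic at y and locate x and z on its two halves: six possible orders.
  noneBetween⇒generalPosition none x y z x∈R y∈R z∈R x≢y y≢z x≢z (_ , _ , _ , p , shortest , x∈p , y∈p , z∈p)
    with split y∈p
  ... | split-at {i} p₁ p₂ refl cover with cover x∈p | cover z∈p
  ... | inj₁ x∈p₁ | inj₂ z∈p₂ with split x∈p₁ | split z∈p₂
  ...   | split-at {e₁} {e₂} w₁ w₂ refl _ | split-at w₃ w₄ refl _ =
    none x∈R y∈R z∈R x≢y y≢z x≢z (shortest⇒between p shortest w₁ w₂ w₃ w₄ (sym (+-assoc e₁ e₂ _)))
  noneBetween⇒generalPosition none x y z x∈R y∈R z∈R x≢y y≢z x≢z (_ , _ , _ , p , shortest , _)
      | split-at p₁ p₂ refl cover | inj₂ x∈p₂ | inj₁ z∈p₁ with split z∈p₁ | split x∈p₂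
  ...   | split-at {e₁} {e₂} w₁ w₂ refl _ | split-at w₃ w₄ refl _ =
    none z∈R y∈R x∈R (y≢z ∘ sym) (x≢y ∘ sym) (x≢z ∘ sym)
      (shortest⇒between p shortest w₁ w₂ w₃ w₄ (sym (+-assoc e₁ e₂ _)))
  noneBetween⇒generalPosition none x y z x∈R y∈R z∈R x≢y y≢z x≢z (_ , _ , _ , p , shortest , _)
      | split-at {_} {j} p₁ p₂ refl cover | inj₁ x∈p₁ | inj₁ z∈p₁ with split x∈p₁
  ... | split-at {e₁} {e₂} w₁ w₂ refl cover₁ with cover₁ z∈p₁
  ...   | inj₁ z∈w₁ with split z∈w₁
  ...     | split-at {g₁} {g₂} v₁ v₂ refl _ =
    none z∈R x∈R y∈R (x≢z ∘ sym) x≢y (y≢z ∘ sym)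
      (shortest⇒between p shortest v₁ v₂ w₂ p₂
        (trans (sym (+-assoc g₁ g₂ _)) (sym (+-assoc (g₁ + g₂) e₂ j))))
  noneBetween⇒generalPosition none x y z x∈R y∈R z∈R x≢y y≢z x≢z (_ , _ , _ , p , shortest , _)
      | split-at {_} {j} p₁ p₂ refl cover | inj₁ x∈p₁ | inj₁ z∈p₁ | split-at {e₁} w₁ w₂ refl cover₁
      | inj₂ z∈w₂ with split z∈w₂
  ...     | split-at {g₁} {g₂} v₁ v₂ refl _ =
    none x∈R z∈R y∈R x≢z (y≢z ∘ sym) x≢y
      (shortest⇒between p shortest w₁ v₁ v₂ p₂
        (trans (cong (e₁ +_) (sym (+-assoc g₁ g₂ j))) (sym (+-assoc e₁ (g₁ + g₂) j))))
  noneBetween⇒generalPosition none x y z x∈R y∈R z∈R x≢y y≢z x≢z (_ , _ , _ , p , shortest , _)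
      | split-at {i} p₁ p₂ refl cover | inj₂ x∈p₂ | inj₂ z∈p₂ with split x∈p₂
  ... | split-at {e₁} {e₂} w₁ w₂ refl cover₂ with cover₂ z∈p₂
  ...   | inj₁ z∈w₁ with split z∈w₁
  ...     | split-at {g₁} {g₂} v₁ v₂ refl _ =
    none y∈R z∈R x∈R y≢z (x≢z ∘ sym) (x≢y ∘ sym)
      (shortest⇒between p shortest p₁ v₁ v₂ w₂ (cong (i +_) (sym (+-assoc g₁ g₂ e₂))))
  noneBetween⇒generalPosition none x y z x∈R y∈R z∈R x≢y y≢z x≢z (_ , _ , _ , p , shortest , _)
      | split-at p₁ p₂ refl cover | inj₂ x∈p₂ | inj₂ z∈p₂ | split-at w₁ w₂ refl cover₂
      | inj₂ z∈w₂ with split z∈w₂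
  ...     | split-at v₁ v₂ refl _ =
    none y∈R x∈R z∈R (x≢y ∘ sym) x≢z y≢z (shortest⇒between p shortest p₁ w₁ v₁ v₂ refl)

  deg≡1⇒¬between : ∀ {a b c} → deg G b ≡ 1 → a ≢ b → b ≢ c → ¬ Between a b c
  deg≡1⇒¬between d≡1 a≢b b≢c (zero , _ , here _ , _)         = a≢b refl
  deg≡1⇒¬between d≡1 a≢b b≢c (suc _ , zero , _ , here _ , _) = b≢c refl
  deg≡1⇒¬between d≡1 a≢b b≢c (suc i , suc j , w , step e r , shortest)
    with unsnoc w
  ... | _ , r′ , e′ with deg≡1⇒neighbour-unique d≡1 (Adj-sym e′) e
  ... | refl = 1+n≰n (<⇒≤ (subst (_≤ i + j) (cong suc (+-suc i j)) (shortest _ (r′ ++ʷ r))))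

  commonNeighbour∧between⇒Adj : ∀ {a b c q} → Adj G a q → Adj G q c →
                                a ≢ b → b ≢ c → Between a b c → Adj G a b
  commonNeighbour∧between⇒Adj _ _ a≢b b≢c (zero , _ , here _ , _)          = ⊥-elim (a≢b refl)
  commonNeighbour∧between⇒Adj _ _ a≢b b≢c (suc _ , zero , _ , here _ , _)  = ⊥-elim (b≢c refl)
  commonNeighbour∧between⇒Adj _ _ _ _ (1 , suc _ , step e (here _) , _)     = e
  commonNeighbour∧between⇒Adj {c = c} e₁ e₂ _ _ (suc (suc i) , suc j , _ , _ , shortest)
    with m+n≤o⇒n≤o i (≤-pred (≤-pred (shortest 2 (step e₁ (step e₂ (here c))))))
  ... | ()

  Peelable : Fin n → Subset n → Fin n → Set
  Peelable u A v = ∣ A ∩ nbhd G v ∣ ≤ 1 × (v ≡ u → ∣ A ∩ nbhd G v ∣ ≡ 0)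

  Peelable-⊤ : ∀ {u v} → Peelable u ⊤ v → deg G v ≤ 1 × (v ≡ u → deg G v ≡ 0)
  Peelable-⊤ {u} {v} = subst (λ d → d ≤ 1 × (v ≡ u → d ≡ 0)) (cong ∣_∣ (∩-identityˡ (nbhd G v)))

  Peelable-⊆ : ∀ {u A B v} → A ∩ nbhd G v ⊆ B ∩ nbhd G v → Peelable u B v → Peelable u A v
  Peelable-⊆ A⊆B (≤1 , ≡0) = ≤-trans size≤ ≤1 , λ v≡u → n≤0⇒n≡0 (≤-trans size≤ (≤-reflexive (≡0 v≡u)))
    where size≤ = p⊆q⇒∣p∣≤∣q∣ A⊆B

module _ {A : Set} where

  prefixTo : ∀ {y x xs} → y ∈ₗ x ∷ xs → List A
  prefixTo {x = x} (here _)                 = x ∷ []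
  prefixTo {x = x} {xs = _ ∷ _} (there y∈) = x ∷ prefixTo y∈

  All-prefixTo : ∀ {P : A → Set} {y x xs} → All P (x ∷ xs) → (y∈ : y ∈ₗ x ∷ xs) → All P (prefixTo y∈)
  All-prefixTo (px ∷ _)                   (here _)   = px ∷ []
  All-prefixTo {xs = _ ∷ _} (px ∷ pxs) (there y∈) = px ∷ All-prefixTo pxs y∈

  Unique-prefixTo : ∀ {y x xs} → Unique (x ∷ xs) → (y∈ : y ∈ₗ x ∷ xs) → Unique (prefixTo y∈)
  Unique-prefixTo _                          (here _)   = [] ∷ []
  Unique-prefixTo {xs = _ ∷ _} (x∉ ∷ uniq) (there y∈) = All-prefixTo x∉ y∈ ∷ Unique-prefixTo uniq y∈

  last-prefixTo : ∀ {y x xs} (y∈ : y ∈ₗ x ∷ xs) → last (prefixTo y∈) ≡ just y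
  last-prefixTo (here refl)                                = refl
  last-prefixTo {xs = _ ∷ _}     (there (here refl))       = refl
  last-prefixTo {xs = _ ∷ _ ∷ _} (there (there y∈))        = last-prefixTo (there y∈)

  0<length-prefixTo : ∀ {y x xs} (y∈ : y ∈ₗ x ∷ xs) → 0 < length (prefixTo y∈)
  0<length-prefixTo (here _)                = s≤s z≤n
  0<length-prefixTo {xs = _ ∷ _} (there _) = s≤s z≤n

module _ {n : ℕ} (G : Graph n) where

  Chain-prefixTo : ∀ {y x xs} → Chain G (x ∷ xs) → (y∈ : y ∈ₗ x ∷ xs) → Chain G (prefixTo y∈)
  Chain-prefixTo {x = x} _ (here _) = c-one x
  Chain-prefixTo (c-cons x x₂ xs e chain) (there y∈) = cons e y∈ (Chain-prefixTo chain y∈)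
    where
    cons : ∀ {y xs} → Adj G x x₂ → (y∈ : y ∈ₗ x₂ ∷ xs) → Chain G (prefixTo y∈) → Chain G (x ∷ prefixTo y∈)
    cons e (here _)                 chain = c-cons x x₂ [] e chain
    cons e (there {xs = _ ∷ _} y∈) chain = c-cons x x₂ (prefixTo y∈) e chain

module _ {m : ℕ} (T : Graph m) (acyclic : Acyclic T) where

  open import Data.List.Membership.DecPropositional (_≟ᶠ_ {m}) using () renaming (_∈?_ to _∈ₗ?_)

  noChord : ∀ {h s rest w} → Unique (h ∷ s ∷ rest) → Chain T (h ∷ s ∷ rest) → w ∈ₗ rest → ¬ Adj T h w
  noChord {rest = _ ∷ _} uniq chain w∈rest e =
    acyclic (prefixTo cycle)
      ( s≤s (s≤s (0<length-prefixTo w∈rest)) , Unique-prefixTo uniq cycle , Chain-prefixTo T chain cycle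
      , _ , _ , refl , last-prefixTo cycle , Adj-sym T e)
    where cycle = there (there w∈rest)

  -- The path starts at u whenever u ∈ A, so its head is never u.
  record PathIn (u : Fin m) (A : Subset m) (h s : Fin m) (rest : List (Fin m)) : Set where
    field
      unique   : Unique (h ∷ s ∷ rest)
      chain    : Chain T (h ∷ s ∷ rest)
      within   : All (_∈ A) (h ∷ s ∷ rest)
      u-behind : u ∈ₗ s ∷ rest ⊎ u ∉ A

  extendPath : ∀ {u A h s rest w} → PathIn u A h s rest → w ∈ A → Adj T h w → w ∉ₗ h ∷ s ∷ rest →
               PathIn u A w h (s ∷ rest)
  extendPath path w∈A e w∉ = record
    { unique   = ¬Any⇒All¬ _ w∉ ∷ unique
    ; chain    = c-cons _ _ _ (Adj-sym T e) chain
    ; within   = w∈A ∷ within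
    ; u-behind = map₁ there u-behind
    }
    where open PathIn path

  stuck⇒peelable : ∀ {u A h s rest} → PathIn u A h s rest →
                   (∀ {w} → w ∈ A ∩ nbhd T h → w ∈ₗ h ∷ s ∷ rest) → Peelable T u A h
  stuck⇒peelable {u} {A} {h} {s} path stuck = p⊆⁅x⁆⇒∣p∣≤1 onlyS , ⊥-elim ∘ h≢u
    where
    open PathIn path
    onlyS : A ∩ nbhd T h ⊆ ⁅ s ⁆
    onlyS w∈ with stuck w∈ | ∈nbhd⇒Adj T (proj₂ (x∈p∩q⁻ A _ w∈))
    ... | here refl            | e = ⊥-elim (Adj⇒≢ T e refl)
    ... | there (here refl)    | _ = x∈⁅x⁆ s
    ... | there (there w∈rest) | e = ⊥-elim (noChord unique chain w∈rest e)
    h≢u : h ≢ u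
    h≢u refl with unique | within | u-behind
    ... | h∉ ∷ _ | _       | inj₁ h∈  = All.lookup h∉ h∈ refl
    ... | _      | h∈A ∷ _ | inj₂ h∉A = h∉A h∈A

  path⇒∃-peelable : ∀ {u A h s rest} k (N : Subset m) → ∣ N ∣ ≤ k →
                    (∀ {v} → v ∈ A → v ∉ₗ h ∷ s ∷ rest → v ∈ N) → PathIn u A h s rest →
                    ∃ λ ℓ → ℓ ∈ A × Peelable T u A ℓ
  path⇒∃-peelable {u} {A} {h} {s} {rest} k N ∣N∣≤k N⊇ path
    with any? (λ w → (w ∈? (A ∩ nbhd T h)) ×-dec ¬? (w ∈ₗ? h ∷ s ∷ rest))
  ... | no stuck = h , All.head (PathIn.within path) , stuck⇒peelable path onPath
    where
    onPath : ∀ {w} → w ∈ A ∩ nbhd T h → w ∈ₗ h ∷ s ∷ rest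
    onPath {w} w∈ with w ∈ₗ? h ∷ s ∷ rest
    ... | yes w∈path = w∈path
    ... | no  w∉path = ⊥-elim (stuck (w , w∈ , w∉path))
  ... | yes (w , w∈ , w∉path) with x∈p∩q⁻ A _ w∈ | k
  ...   | w∈A , _ | zero  = ⊥-elim (1+n≰n (≤-trans (x∈p⇒0<∣p∣ (N⊇ w∈A w∉path)) ∣N∣≤k))
  ...   | w∈A , e | suc k =
    path⇒∃-peelable k (N - w)
      (≤-pred (≤-trans (x∈p⇒∣p-x∣<∣p∣ (N⊇ w∈A w∉path)) ∣N∣≤k))
      (λ v∈A v∉ → x∈p∧x≢y⇒x∈p-y (N⊇ v∈A (v∉ ∘ there)) (v∉ ∘ here))
      (extendPath path w∈A (∈nbhd⇒Adj T e) w∉path)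

  ∃-peelable-from : ∀ {u A s} → s ∈ A → u ∈ₗ s ∷ [] ⊎ u ∉ A → ∃ λ ℓ → ℓ ∈ A × Peelable T u A ℓ
  ∃-peelable-from {u} {A} {s} s∈A u-behind with nonempty? (A ∩ nbhd T s)
  ... | no empty = s , s∈A , ≤-trans (≤-reflexive ∣∣≡0) z≤n , λ _ → ∣∣≡0
    where ∣∣≡0 = Empty⇒∣p∣≡0 empty
  ... | yes (w , w∈) with x∈p∩q⁻ A _ w∈
  ...   | w∈A , e = path⇒∃-peelable ∣ A ∣ A ≤-refl (λ v∈A _ → v∈A) (record
    { unique   = (Adj⇒≢ T (Adj-sym T sw) ∷ []) ∷ [] ∷ []
    ; chain    = c-cons w s [] (Adj-sym T sw) (c-one s)
    ; within   = w∈A ∷ s∈A ∷ []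
    ; u-behind = u-behind
    })
    where sw = ∈nbhd⇒Adj T e

  ∃-peelable : ∀ u {A} → Nonempty A → ∃ λ ℓ → ℓ ∈ A × Peelable T u A ℓ
  ∃-peelable u {A} (a , a∈A) with u ∈? A
  ... | yes u∈A = ∃-peelable-from u∈A (inj₁ (here refl))
  ... | no  u∉A = ∃-peelable-from a∈A (inj₂ u∉A)

data PunchView {m : ℕ} (q : Fin (suc m)) : Fin (suc m) → Set where
  at-q    : PunchView q q
  punched : ∀ i → PunchView q (punchIn q i)

punchView : ∀ {m} (q z : Fin (suc m)) → PunchView q z
punchView q z with q ≟ᶠ z
... | yes refl = at-q
... | no  q≢z  = subst (PunchView q) (punchIn-punchOut q≢z) (punched (punchOut q≢z))

module _ {m : ℕ} (G : Graph (suc m)) (q : Fin (suc m)) (acyclic : Acyclic (deleteVertex G q))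
         {S : Subset (suc m)} (q∈S : q ∈ S) where

  private
    T : Graph m
    T = deleteVertex G q

    Blackᵀ : Fin m → Set
    Blackᵀ i = Black G S (punchIn q i)

  forceNeighbour : ∀ {A ℓ} → (∀ {i} → i ∉ A → Blackᵀ i) → Blackᵀ ℓ → ∣ A ∩ nbhd T ℓ ∣ ≤ 1 →
                   ∀ {i} → i ∈ A → Adj T ℓ i → Blackᵀ i
  forceNeighbour {A} {ℓ} outside-black ℓ-black ∣∣≤1 {i} i∈A e = force ℓ-black e othersBlack
    where
    othersBlack : ∀ z → Adj G (punchIn q ℓ) z → z ≢ punchIn q i → Black G S z
    othersBlack z e′ z≢i with punchView q z
    ... | at-q = initial q∈S
    ... | punched j with j ∈? A
    ...   | no  j∉A = outside-black j∉A
    ...   | yes j∈A = ⊥-elim (z≢i (cong (punchIn q)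
              (∣p∣≤1⇒x∈p∧y∈p⇒x≡y ∣∣≤1 (x∈p∩q⁺ (j∈A , Adj⇒∈nbhd T e′)) (x∈p∩q⁺ (i∈A , Adj⇒∈nbhd T e)))))

  blackByPeeling : ∀ {u} k A → ∣ A ∣ ≤ k → (∀ {i} → i ∉ A → Blackᵀ i) →
                   (∀ {i} → i ∈ A → Peelable T u A i → Blackᵀ i) → ∀ i → Blackᵀ i
  blackByPeeling {u} k A ∣A∣≤k outside-black peelable-black with nonempty? A
  ... | no empty = λ i → outside-black (λ i∈A → empty (i , i∈A))
  ... | yes ne with ∃-peelable T acyclic u ne | k
  ...   | ℓ , ℓ∈A , _ | zero = ⊥-elim (1+n≰n (≤-trans (x∈p⇒0<∣p∣ ℓ∈A) ∣A∣≤k))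
  ...   | ℓ , ℓ∈A , ℓ-peelable | suc k =
    blackByPeeling k (A - ℓ) (≤-pred (≤-trans (x∈p⇒∣p-x∣<∣p∣ ℓ∈A) ∣A∣≤k)) outside-black′ peelable-black′
    where
    ℓ-black : Blackᵀ ℓ
    ℓ-black = peelable-black ℓ∈A ℓ-peelable

    outside-black′ : ∀ {i} → i ∉ A - ℓ → Blackᵀ i
    outside-black′ {i} i∉ with i ≟ᶠ ℓ
    ... | yes refl = ℓ-black
    ... | no  i≢ℓ  = outside-black (λ i∈A → i∉ (x∈p∧x≢y⇒x∈p-y i∈A i≢ℓ))

    peelable-black′ : ∀ {i} → i ∈ A - ℓ → Peelable T u (A - ℓ) i → Blackᵀ i
    peelable-black′ {i} i∈ i-peelable with adj T ℓ i in e
    ... | true  = forceNeighbour outside-black ℓ-black (proj₁ ℓ-peelable) (p─q⊆p A ⁅ ℓ ⁆ i∈) e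
    ... | false = peelable-black (p─q⊆p A ⁅ ℓ ⁆ i∈) (Peelable-⊆ T shrink i-peelable)
      where
      shrink : A ∩ nbhd T i ⊆ (A - ℓ) ∩ nbhd T i
      shrink w∈ with x∈p∩q⁻ A _ w∈
      ... | w∈A , w∈N = x∈p∩q⁺ (x∈p∧x≢y⇒x∈p-y w∈A ℓ∉N , w∈N)
        where
        ℓ∉N : _ ≢ ℓ
        ℓ∉N refl with trans (sym e) (Adj-sym T (∈nbhd⇒Adj T w∈N))
        ... | ()

  zeroForcing-allButOnePendant : ∀ u → (∀ {i} → deg T i ≤ 1 → (i ≡ u → deg T i ≡ 0) → punchIn q i ∈ S) →
                                 ZeroForcing G S
  zeroForcing-allButOnePendant u pendants∈S v with punchView q v
  ... | at-q      = initial q∈S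
  ... | punched i = blackByPeeling _ ⊤ ≤-refl (λ i∉⊤ → ⊥-elim (i∉⊤ ∈⊤)) initialBlack i
    where
    initialBlack : ∀ {i} → i ∈ ⊤ → Peelable T u ⊤ i → Blackᵀ i
    initialBlack _ peelable = initial (uncurry pendants∈S (Peelable-⊤ T peelable))

deg-punchIn : ∀ {m} (G : Graph (suc m)) q i →
              deg G (punchIn q i) ≡ ∣ adj G (punchIn q i) q ∷ nbhd (deleteVertex G q) i ∣
deg-punchIn G q i = ∣tabulate∣-punchIn (adj G (punchIn q i)) q

generalPosition-⊤₂ : (G : Graph 2) → GeneralPosition G ⊤
generalPosition-⊤₂ G zero       zero       _          _ _ _ x≢y _   _   _ = x≢y refl
generalPosition-⊤₂ G (suc zero) (suc zero) _          _ _ _ x≢y _   _   _ = x≢y refl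
generalPosition-⊤₂ G _          zero       zero       _ _ _ _   y≢z _   _ = y≢z refl
generalPosition-⊤₂ G _          (suc zero) (suc zero) _ _ _ _   y≢z _   _ = y≢z refl
generalPosition-⊤₂ G zero       (suc zero) zero       _ _ _ _   _   x≢z _ = x≢z refl
generalPosition-⊤₂ G (suc zero) zero       (suc zero) _ _ _ _   _   x≢z _ = x≢z refl

module QuasiTree {k : ℕ} (G : Graph (3 + k)) (q : Fin (3 + k)) (quasi : IsQuasiVertex G q) where

  T : Graph (2 + k)
  T = deleteVertex G q

  connected : Connected T
  connected = proj₁ (proj₂ quasi)

  acyclic : Acyclic T
  acyclic = proj₂ (proj₂ quasi)

  0<deg : ∀ i → 0 < deg T i
  0<deg zero    = connected⇒0<deg T connected {w = suc zero} (λ ())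
  0<deg (suc i) = connected⇒0<deg T connected {w = zero} (λ ())

  pendant? : ∀ v → Dec (∃ λ i → punchIn q i ≡ v × deg T i ≡ 1)
  pendant? v = any? (λ i → (punchIn q i ≟ᶠ v) ×-dec (deg T i ≟ℕ 1))

  pendants : Subset (3 + k)
  pendants = tabulate (does ∘ pendant?)

  punchIn∈pendants : ∀ {i} → deg T i ≡ 1 → punchIn q i ∈ pendants
  punchIn∈pendants {i} d≡1 = ∈tabulate⁺ {f = does ∘ pendant?} (dec-true (pendant? _) (i , refl , d≡1))

  ∈pendants⁻ : ∀ {v} → v ∈ pendants → ∃ λ i → punchIn q i ≡ v × deg T i ≡ 1
  ∈pendants⁻ {v} v∈ = witness (pendant? v) (∈tabulate⁻ {f = does ∘ pendant?} v∈)
    where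
    witness : ∀ {A : Set} (a? : Dec A) → does a? ≡ true → A
    witness (yes a) _ = a

  ∃-pendant : ∃ λ u → deg T u ≡ 1
  ∃-pendant with ∃-peelable T acyclic zero (zero , ∈⊤)
  ... | u , _ , u-peelable = u , ≤-antisym (proj₁ (Peelable-⊤ T u-peelable)) (0<deg u)

  u : Fin (2 + k)
  u = proj₁ ∃-pendant

  forcingSet : Subset (3 + k)
  forcingSet = (pendants - punchIn q u) ∪ ⁅ q ⁆

  ∣forcingSet∣≤∣pendants∣ : ∣ forcingSet ∣ ≤ ∣ pendants ∣
  ∣forcingSet∣≤∣pendants∣ = begin
    ∣ forcingSet ∣                              ≤⟨ ∣p∪q∣≤∣p∣+∣q∣ (pendants - punchIn q u) ⁅ q ⁆ ⟩
    ∣ pendants - punchIn q u ∣ + ∣ ⁅ q ⁆ ∣     ≡⟨ cong (∣ pendants - punchIn q u ∣ +_) (∣⁅x⁆∣≡1 q) ⟩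
    ∣ pendants - punchIn q u ∣ + 1             ≡⟨ +-comm _ 1 ⟩
    suc ∣ pendants - punchIn q u ∣             ≤⟨ x∈p⇒∣p-x∣<∣p∣ (punchIn∈pendants (proj₂ ∃-pendant)) ⟩
    ∣ pendants ∣                               ∎
    where open ≤-Reasoning

  forcingSet-zeroForcing : ZeroForcing G forcingSet
  forcingSet-zeroForcing = zeroForcing-allButOnePendant G q acyclic (x∈p∪q⁺ (inj₂ (x∈⁅x⁆ q))) u pendant∈
    where
    pendant∈ : ∀ {i} → deg T i ≤ 1 → (i ≡ u → deg T i ≡ 0) → punchIn q i ∈ forcingSet
    pendant∈ {i} ≤1 u⇒0 = x∈p∪q⁺ (inj₁ (x∈p∧x≢y⇒x∈p-y (punchIn∈pendants d≡1) i≢u))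
      where
      d≡1 = ≤-antisym ≤1 (0<deg i)
      i≢u : punchIn q i ≢ punchIn q u
      i≢u eq with trans (sym d≡1) (u⇒0 (punchIn-injective q i u eq))
      ... | ()

  deg-nonadjacent : ∀ {i} → adj G (punchIn q i) q ≡ false → deg G (punchIn q i) ≡ deg T i
  deg-nonadjacent {i} e = trans (deg-punchIn G q i) (cong (λ b → ∣ b ∷ nbhd T i ∣) e)

  deg-adjacent : ∀ {i} → Adj G (punchIn q i) q → deg G (punchIn q i) ≡ suc (deg T i)
  deg-adjacent {i} e = trans (deg-punchIn G q i) (cong (λ b → ∣ b ∷ nbhd T i ∣) e)

  pendant-adjacent : (∀ v → deg G v ≢ 1) → ∀ {i} → deg T i ≡ 1 → Adj G (punchIn q i) q
  pendant-adjacent noPendant {i} d≡1 with adj G (punchIn q i) q in e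
  ... | true  = refl
  ... | false = ⊥-elim (noPendant _ (trans (deg-nonadjacent e) d≡1))

  pendant-deg≡1 : (∀ y → Adj G q y → deg G y ≢ 2) → ∀ {i} → deg T i ≡ 1 → deg G (punchIn q i) ≡ 1
  pendant-deg≡1 no2 {i} d≡1 with adj G (punchIn q i) q in e
  ... | true  = ⊥-elim (no2 _ (Adj-sym G e) (trans (deg-adjacent e) (cong suc d≡1)))
  ... | false = trans (deg-nonadjacent e) d≡1

  noneBetween-noPendant : (∀ v → deg G v ≢ 1) → NoneBetween G pendants
  noneBetween-noPendant noPendant a∈ b∈ c∈ a≢b b≢c a≢c between
    with ∈pendants⁻ a∈ | ∈pendants⁻ b∈ | ∈pendants⁻ c∈
  ... | ia , refl , da | ib , refl , db | ic , refl , dc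
    with adjacentPendants-closed T da db
           (commonNeighbour∧between⇒Adj G (pendant-adjacent noPendant da)
             (Adj-sym G (pendant-adjacent noPendant dc)) a≢b b≢c between)
           (inj₁ refl) (proj₂ (connected ia ic))
  ... | inj₁ refl = a≢c refl
  ... | inj₂ refl = b≢c refl

  noneBetween-noDeg2Neighbour : (∀ y → Adj G q y → deg G y ≢ 2) → NoneBetween G pendants
  noneBetween-noDeg2Neighbour no2 a∈ b∈ c∈ a≢b b≢c a≢c with ∈pendants⁻ b∈
  ... | ib , refl , db = deg≡1⇒¬between G (pendant-deg≡1 no2 db) a≢b b≢c

  z≤g : GeneralPosition G pendants → ∀ {z g} → IsZ G z → IsGP G g → z ≤ g
  z≤g gp (_ , z-min) (_ , g-max) =
    ≤-trans (z-min forcingSet forcingSet-zeroForcing) (≤-trans ∣forcingSet∣≤∣pendants∣ (g-max pendants gp))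

theorem3p2 : {m : ℕ} (G : Graph (suc m)) → IsQuasiTree G →
    ((∀ v → deg G v ≢ 1) ⊎
     (Σ (Fin (suc m)) λ x → IsQuasiVertex G x × (∀ y → Adj G x y → deg G y ≢ 2))) →
    ∀ z g → IsZ G z → IsGP G g → z ≤ g
theorem3p2 {zero} G (_ , () , _) _ _ _ _ _
theorem3p2 {suc zero} G _ _ _ _ (_ , z-min) (_ , g-max) =
  ≤-trans (z-min ⊤ (λ _ → initial ∈⊤)) (g-max ⊤ (generalPosition-⊤₂ G))
theorem3p2 {suc (suc _)} G (q , quasi) (inj₁ noPendant) _ _ =
  z≤g (noneBetween⇒generalPosition G (noneBetween-noPendant noPendant))
  where open QuasiTree G q quasi
theorem3p2 {suc (suc _)} G _ (inj₂ (x , quasi , no2)) _ _ =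
  z≤g (noneBetween⇒generalPosition G (noneBetween-noDeg2Neighbour no2))
  where open QuasiTree G x quasi
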